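{- Let $\lambda$ be a partition, let $\mu$ be the largest strict partition contained in $\lambda$, and let $n\ge\ell(\lambda)$. Then $\deg G_{\mu,n}=\deg G_{\lambda,n}$.
   Context: Partitions are drawn in French convention (row $i$ from the bottom has $\lambda_i$ boxes, left-justified). A strict partition has distinct nonzero parts; the largest strict partition contained in $\lambda$ is the strict $\mu$ with $\mu_i\le\lambda_i$ for all $i$ of maximal size. A set-valued tableau of shape $\lambda$ assigns to each box $\mathsf B$ a nonempty finite set $T(\mathsf B)$ of positive integers with $\max T(\mathsf B)<\min T(\text{box above})$ and $\max T(\mathsf B)\le\min T(\text{box to the right})$ whenever these exist; $\mathrm{SVT}(\lambda,n)$ consists of those with entries in $\{1,\dots,n\}$. The content $c(T)$ has $i$-th entry the number of occurrences of $i$ in $T$, and $d(T)=\sum_ic(T)_i$. The symmetric Grothendieck polynomial is $G_{\lambda,n}=\sum_{T\in\mathrm{SVT}(\lambda,n)}(-1)^{d(T)-|\lambda|}\mathbf{x}^{c(T)}$; $\deg$ is total degree in $x_1,\dots,x_n$. -}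

module Defs where

open import Data.Bool using (Bool; true; false; _∧_; _∨_; not)
open import Data.Nat as ℕ using (ℕ; zero; suc; _≤_; _<_; _≤ᵇ_; _<ᵇ_)
open import Data.Integer as ℤ using (ℤ; -_; 0ℤ; 1ℤ)
open import Data.Fin using (Fin; toℕ)
open import Data.List using (List; []; _∷_; length; map; concatMap; concat; foldr; zipWith; allFin; filter)
open import Data.Nat.ListAction using (sum)
open import Data.Bool.ListAction using (and; or)
open import Data.Vec as Vec using (Vec; lookup; tabulate; toList)
open import Data.Vec.Properties using (≡-dec)
open import Data.Product using (Σ; _×_; ∃)
open import Relation.Binary.PropositionalEquality using (_≡_; _≢_)

-- Partitions (lists of parts, part i = row i+1 from the bottom)

-- i-th part (0-indexed), 0 beyond the length
part : List ℕ → ℕ → ℕ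
part []       _       = 0
part (x ∷ _)  zero    = x
part (_ ∷ xs) (suc i) = part xs i

data Decreasing : List ℕ → Set where
  []  : Decreasing []
  [_] : ∀ x → Decreasing (x ∷ [])
  _∷_ : ∀ {x y xs} → y ≤ x → Decreasing (y ∷ xs) → Decreasing (x ∷ y ∷ xs)

data StrictlyDecreasing : List ℕ → Set where
  []  : StrictlyDecreasing []
  [_] : ∀ x → StrictlyDecreasing (x ∷ [])
  _∷_ : ∀ {x y xs} → y < x → StrictlyDecreasing (y ∷ xs) → StrictlyDecreasing (x ∷ y ∷ xs)

data Positive : List ℕ → Set where
  []  : Positive []
  _∷_ : ∀ {x xs} → 0 < x → Positive xs → Positive (x ∷ xs)

IsPartition : List ℕ → Set
IsPartition λ' = Decreasing λ' × Positive λ'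

IsStrictPartition : List ℕ → Set
IsStrictPartition μ = StrictlyDecreasing μ × Positive μ

_⊆ₚ_ : List ℕ → List ℕ → Set
μ ⊆ₚ λ' = ∀ i → part μ i ≤ part λ' i

size : List ℕ → ℕ
size = sum

IsLargestStrictIn : List ℕ → List ℕ → Set
IsLargestStrictIn μ λ' =
  IsStrictPartition μ × μ ⊆ₚ λ' ×
  (∀ ν → IsStrictPartition ν → ν ⊆ₚ λ' → size ν ≤ size μ)

-- Set-valued tableaux with entries in {1,…,n}.
-- A subset of {1,…,n} is a Vec Bool n; position k : Fin n stands for the
-- integer (toℕ k + 1).

SubsetN : ℕ → Set
SubsetN n = Vec Bool n

allSubsets : (n : ℕ) → List (SubsetN n)
allSubsets zero    = Vec.[] ∷ []
allSubsets (suc n) = concatMap (λ s → (false Vec.∷ s) ∷ (true Vec.∷ s) ∷ []) (allSubsets n)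

nonempty : ∀ {n} → SubsetN n → Bool
nonempty S = or (map (lookup S) (allFin _))

allLt allLe : ∀ {n} → SubsetN n → SubsetN n → Bool
allLt {n} S S' = and (map (λ x → and (map (λ y →
  not (lookup S x ∧ lookup S' y) ∨ (toℕ x <ᵇ toℕ y)) (allFin n))) (allFin n))
allLe {n} S S' = and (map (λ x → and (map (λ y →
  not (lookup S x ∧ lookup S' y) ∨ (toℕ x ≤ᵇ toℕ y)) (allFin n))) (allFin n))

-- A filling of shape λ: list of rows (bottom row first), row i has λ_i boxes.
Filling : ℕ → Set
Filling n = List (List (SubsetN n))

rowsOf : (n k : ℕ) → List (List (SubsetN n))
rowsOf n zero    = [] ∷ []
rowsOf n (suc k) = concatMap (λ S → map (S ∷_) (rowsOf n k)) (allSubsets n)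

fillings : (n : ℕ) → List ℕ → List (Filling n)
fillings n []       = [] ∷ []
fillings n (k ∷ ks) = concatMap (λ r → map (r ∷_) (fillings n ks)) (rowsOf n k)

rowOK : ∀ {n} → List (SubsetN n) → Bool
rowOK []             = true
rowOK (S ∷ [])       = true
rowOK (S ∷ S' ∷ Ss)  = allLe S S' ∧ rowOK (S' ∷ Ss)

colOK : ∀ {n} → List (SubsetN n) → List (SubsetN n) → Bool
colOK r r' = and (zipWith allLt r r')

columnsOK : ∀ {n} → Filling n → Bool
columnsOK []            = true
columnsOK (r ∷ [])      = true
columnsOK (r ∷ r' ∷ rs) = colOK r r' ∧ columnsOK (r' ∷ rs)

isSVT : ∀ {n} → Filling n → Bool
isSVT T = and (map nonempty (concat T)) ∧ and (map rowOK T) ∧ columnsOK T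

SVT : (n : ℕ) → List ℕ → List (Filling n)
SVT n λ' = filter (λ T → Data.Bool._≟_ (isSVT T) true) (fillings n λ')
  where import Data.Bool

count : Bool → ℕ
count true  = 1
count false = 0

content : ∀ {n} → Filling n → Vec ℕ n
content {n} T = tabulate (λ k → sum (map (λ S → count (lookup S k)) (concat T)))

totalDeg : ∀ {n} → Vec ℕ n → ℕ
totalDeg a = sum (toList a)

dT : ∀ {n} → Filling n → ℕ
dT T = totalDeg (content T)

signPow : ℕ → ℤ
signPow zero    = 1ℤ
signPow (suc k) = - signPow k

sumℤ : List ℤ → ℤ
sumℤ = foldr ℤ._+_ 0ℤ

-- A polynomial in x_1..x_n with integer coefficients, given by its
-- coefficient function on exponent vectors.
Poly : ℕ → Set
Poly n = Vec ℕ n → ℤ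

G : List ℕ → (n : ℕ) → Poly n
G λ' n a = sumℤ (map (λ T → signPow (dT T ℕ.∸ size λ'))
                     (filter (λ T → ≡-dec ℕ._≟_ (content T) a) (SVT n λ')))

HasDegree : ∀ {n} → Poly n → ℕ → Set
HasDegree {n} P d =
  (Σ (Vec ℕ n) λ a → P a ≢ 0ℤ × totalDeg a ≡ d) ×
  (∀ a → P a ≢ 0ℤ → totalDeg a ≤ d)

-- Every monomial of G_{λ,n} coming from a tableau T has coefficient sign (−1)^(d(T)−|λ|),
-- which depends only on the monomial, so there is no cancellation and deg G_{λ,n} is the
-- largest number of entries of a tableau in SVT(λ, n).  Entries weakly increase along rows
-- and strictly increase up columns, so the bottom row, of length y + 1, together with the
-- column above its last box holds at most y + n entries, while the rest of the tableau has
-- width at most y and entries at least 2.  Iterating bounds the number of entries by a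
-- quantity in which the i-th row enters only through μᵢ = min(λᵢ, μᵢ₋₁ − 1), and an
-- explicit tableau attains the bound.  These μᵢ are the parts of the largest strict
-- partition μ ⊆ λ, which therefore gets the same bound.
module Submission where

import Algebra.Properties.CommutativeSemigroup as CommutativeSemigroupProperties
open import Data.Bool using (Bool; true; false; _∧_; _∨_; not; T; if_then_else_)
import Data.Bool as B
open import Data.Bool.ListAction using (all; and)
open import Data.Bool.Properties using (T-≡; T?)
open import Data.Empty using (⊥; ⊥-elim)
open import Data.Fin using (Fin; toℕ; fromℕ<) renaming (zero to fz; suc to fs)
open import Data.Fin.Properties using (toℕ<n; toℕ-fromℕ<; any?)
open import Data.Integer as ℤ using (0ℤ; 1ℤ; -1ℤ; -[1+_])
open import Data.List using (List; []; _∷_; length; map; concat; allFin; filter; _++_; take; drop; replicate)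
open import Data.List.Membership.Propositional using (_∈_; find)
open import Data.List.Membership.Propositional.Properties
  using (∈-allFin; ∈-concatMap⁺; ∈-concatMap⁻; ∈-map⁺; ∈-map⁻; ∈-filter⁺; ∈-filter⁻)
open import Data.List.Properties
  using (map-++; map-∘; map-cong-local; map-id-local; length-map; length-take; length-++; length-replicate;
         drop-all; ∷-injective)
open import Data.List.Relation.Unary.All as All using (All; []; _∷_)
open import Data.List.Relation.Unary.All.Properties as All using (all⁺; all⁻; concat⁺; concat⁻; take⁺)
open import Data.List.Relation.Unary.Any as Any using (here; there)
open import Data.List.Relation.Unary.Any.Properties using (any⁺; any⁻)
open import Data.Nat using (ℕ; zero; suc; _≤_; _<_; _≟_; _≤ᵇ_; _<ᵇ_; z≤n; s≤s; s≤s⁻¹; _+_; _∸_; _⊓_)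
open import Data.Nat.ListAction using (sum)
open import Data.Nat.ListAction.Properties using (sum-++)
open import Data.Nat.Properties
open import Data.Nat.Tactic.RingSolver using (solve-∀)
open import Data.Product as Product using (Σ; _×_; _,_; proj₁; proj₂; ∃)
open import Data.Sum using (_⊎_; inj₁; inj₂)
open import Data.Unit using (⊤)
open import Data.Vec as Vec using (lookup; tabulate; toList)
open import Data.Vec.Properties using (lookup∘tabulate; ≡-dec)
open import Function using (_∘_; Equivalence)
open import Relation.Binary.PropositionalEquality
open import Relation.Nullary using (¬_; yes; no)

open import Defs
open CommutativeSemigroupProperties +-commutativeSemigroup using (interchange)

T-∧⁻ : ∀ {a b} → T (a ∧ b) → T a × T b
T-∧⁻ {true} t = _ , t

T-∧⁺ : ∀ {a b} → T a → T b → T (a ∧ b)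
T-∧⁺ {true} _ t = t

infix 4 _∈ₛ_

_∈ₛ_ : ∀ {n} → Fin n → SubsetN n → Set
p ∈ₛ S = T (lookup S p)

nonempty⇒∃ : ∀ {n} (S : SubsetN n) → T (nonempty S) → ∃ λ p → p ∈ₛ S
nonempty⇒∃ S ne = Any.satisfied (any⁻ (lookup S) (allFin _) ne)

∈ₛ⇒nonempty : ∀ {n} {S : SubsetN n} {p} → p ∈ₛ S → T (nonempty S)
∈ₛ⇒nonempty {S = S} {p} p∈S = any⁺ (lookup S) (Any.map (λ { refl → p∈S }) (∈-allFin p))

-- allLt and allLe are Pairwise _<ᵇ_ and Pairwise _≤ᵇ_ by definition.
Related : ∀ {n} → (ℕ → ℕ → Bool) → SubsetN n → SubsetN n → Fin n → Fin n → Bool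
Related R S S' x y = not (lookup S x ∧ lookup S' y) ∨ R (toℕ x) (toℕ y)

Pairwise : ∀ {n} → (ℕ → ℕ → Bool) → SubsetN n → SubsetN n → Bool
Pairwise {n} R S S' = all (λ x → all (Related R S S' x) (allFin n)) (allFin n)

implication⁻ : ∀ {a b c} → T (not (a ∧ b) ∨ c) → T a → T b → T c
implication⁻ {true} {true} c _ _ = c

implication⁺ : ∀ a b c → (T a → T b → T c) → T (not (a ∧ b) ∨ c)
implication⁺ true  true  _ h = h _ _
implication⁺ true  false _ _ = _
implication⁺ false _     _ _ = _

Pairwise⁻ : ∀ {n} R (S S' : SubsetN n) → T (Pairwise R S S') →
  ∀ {p q} → p ∈ₛ S → q ∈ₛ S' → T (R (toℕ p) (toℕ q))
Pairwise⁻ {n} R S S' h {p} {q} = implication⁻ (All.lookup (all⁺ (Related R S S' p) (allFin n) row) (∈-allFin q))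
  where
  row : T (all (Related R S S' p) (allFin n))
  row = All.lookup (all⁺ (λ x → all (Related R S S' x) (allFin n)) (allFin n) h) (∈-allFin p)

Pairwise⁺ : ∀ {n} R (S S' : SubsetN n) →
  (∀ {p q} → p ∈ₛ S → q ∈ₛ S' → T (R (toℕ p) (toℕ q))) → T (Pairwise R S S')
Pairwise⁺ {n} R S S' h = all⁻ (λ x → all (Related R S S' x) (allFin n)) {xs = allFin n} (All.tabulate λ {p} _ →
  all⁻ (Related R S S' p) {xs = allFin n} (All.tabulate λ {q} _ → implication⁺ (lookup S p) (lookup S' q) _ h))

allLt⇒< : ∀ {n} (S S' : SubsetN n) → T (allLt S S') → ∀ {p q} → p ∈ₛ S → q ∈ₛ S' → toℕ p < toℕ q
allLt⇒< S S' h p∈S q∈S' = <ᵇ⇒< _ _ (Pairwise⁻ _<ᵇ_ S S' h p∈S q∈S')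

allLe⇒≤ : ∀ {n} (S S' : SubsetN n) → T (allLe S S') → ∀ {p q} → p ∈ₛ S → q ∈ₛ S' → toℕ p ≤ toℕ q
allLe⇒≤ S S' h p∈S q∈S' = ≤ᵇ⇒≤ _ _ (Pairwise⁻ _≤ᵇ_ S S' h p∈S q∈S')

<⇒allLt : ∀ {n} (S S' : SubsetN n) → (∀ {p q} → p ∈ₛ S → q ∈ₛ S' → toℕ p < toℕ q) → T (allLt S S')
<⇒allLt S S' h = Pairwise⁺ _<ᵇ_ S S' (λ p∈S q∈S' → <⇒<ᵇ (h p∈S q∈S'))

≤⇒allLe : ∀ {n} (S S' : SubsetN n) → (∀ {p q} → p ∈ₛ S → q ∈ₛ S' → toℕ p ≤ toℕ q) → T (allLe S S')
≤⇒allLe S S' h = Pairwise⁺ _≤ᵇ_ S S' (λ p∈S q∈S' → ≤⇒≤ᵇ (h p∈S q∈S'))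

maximum : ∀ {n} (S : SubsetN n) → ∃ (λ p → p ∈ₛ S) →
  Σ (Fin n) λ m → m ∈ₛ S × (∀ {q} → q ∈ₛ S → toℕ q ≤ toℕ m)
maximum (b Vec.∷ S) (p , p∈S) with any? (λ q → T? (lookup S q))
... | yes (q , q∈S) =
  let (m , m∈S , max) = maximum S (q , q∈S)
  in fs m , m∈S , λ { {fz} _ → z≤n ; {fs q} e → s≤s (max e) }
... | no S≡∅ with p
...   | fz   = fz , p∈S , λ { {fz} _ → z≤n ; {fs q} q∈S → ⊥-elim (S≡∅ (q , q∈S)) }
...   | fs q = ⊥-elim (S≡∅ (q , p∈S))

interval : ∀ {n} → ℕ → ℕ → SubsetN n
interval a b = tabulate (λ k → (a ≤ᵇ toℕ k) ∧ (toℕ k ≤ᵇ b))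

∈-interval⁻ : ∀ {n} a b {p : Fin n} → p ∈ₛ interval a b → a ≤ toℕ p × toℕ p ≤ b
∈-interval⁻ a b {p} p∈ rewrite lookup∘tabulate (λ k → (a ≤ᵇ toℕ k) ∧ (toℕ k ≤ᵇ b)) p =
  let (l , u) = T-∧⁻ p∈ in ≤ᵇ⇒≤ _ _ l , ≤ᵇ⇒≤ _ _ u

∈-interval⁺ : ∀ {n a b} {p : Fin n} → a ≤ toℕ p → toℕ p ≤ b → p ∈ₛ interval a b
∈-interval⁺ {a = a} {b} {p} l u rewrite lookup∘tabulate (λ k → (a ≤ᵇ toℕ k) ∧ (toℕ k ≤ᵇ b)) p =
  T-∧⁺ (≤⇒≤ᵇ l) (≤⇒≤ᵇ u)

interval-nonempty : ∀ {n a b} → a ≤ b → b < n → T (nonempty {n} (interval a b))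
interval-nonempty {n} {a} {b} a≤b b<n = ∈ₛ⇒nonempty {S = interval {n} a b}
  (∈-interval⁺ (subst (_ ≤_) (sym (toℕ-fromℕ< b<n)) a≤b) (≤-reflexive (toℕ-fromℕ< b<n)))

card : ∀ {n} → SubsetN n → ℕ
card Vec.[]       = 0
card (b Vec.∷ S) = count b + card S

cardʳ : ∀ {n} → List (SubsetN n) → ℕ
cardʳ r = sum (map card r)

cardᶠ : ∀ {n} → Filling n → ℕ
cardᶠ F = sum (map cardʳ F)

card-⊆-interval : ∀ {n} (S : SubsetN n) {a b} → a ≤ b →
  (∀ {p} → p ∈ₛ S → a ≤ toℕ p × toℕ p < b) → card S + a ≤ b
card-⊆-interval Vec.[]            a≤b _ = a≤b
card-⊆-interval (true Vec.∷ S)  {zero}  {zero}  _ h with () ← proj₂ (h {fz} _)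
card-⊆-interval (true Vec.∷ S)  {zero}  {suc b} _ h =
  s≤s (card-⊆-interval S z≤n λ p∈S → z≤n , s≤s⁻¹ (proj₂ (h {fs _} p∈S)))
card-⊆-interval (false Vec.∷ S) {zero}  {b}     _ h =
  card-⊆-interval S z≤n λ p∈S → z≤n , <-trans (n<1+n _) (proj₂ (h {fs _} p∈S))
card-⊆-interval (true Vec.∷ S)  {suc a} _ h with () ← proj₁ (h {fz} _)
card-⊆-interval (false Vec.∷ S) {suc a} {suc b} (s≤s a≤b) h =
  subst (_≤ suc b) (sym (+-suc (card S) a))
    (s≤s (card-⊆-interval S a≤b λ p∈S → let (l , u) = h {fs _} p∈S in s≤s⁻¹ l , s≤s⁻¹ u))

card-⊇-interval : ∀ {n} (S : SubsetN n) a b → b < n →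
  (∀ {p} → a ≤ toℕ p → toℕ p ≤ b → p ∈ₛ S) → suc b ∸ a ≤ card S
card-⊇-interval (x Vec.∷ S) zero    zero    _         h with x | h {fz} z≤n z≤n
... | true | _ = s≤s z≤n
card-⊇-interval (x Vec.∷ S) zero    (suc b) (s≤s b<n) h with x | h {fz} z≤n z≤n
... | true | _ = s≤s (card-⊇-interval S 0 b b<n λ _ p≤b → h z≤n (s≤s p≤b))
card-⊇-interval (x Vec.∷ S) (suc a) zero    _         _ = subst (_≤ card (x Vec.∷ S)) (sym (0∸n≡0 a)) z≤n
card-⊇-interval (x Vec.∷ S) (suc a) (suc b) (s≤s b<n) h =
  ≤-trans (card-⊇-interval S a b b<n λ a≤p p≤b → h (s≤s a≤p) (s≤s p≤b)) (m≤n+m (card S) (count x))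

sum-tabulate-0 : ∀ n → sum (toList (tabulate {n = n} (λ _ → 0))) ≡ 0
sum-tabulate-0 zero    = refl
sum-tabulate-0 (suc n) = sum-tabulate-0 n

sum-tabulate-+ : ∀ n (f g : Fin n → ℕ) → sum (toList (tabulate (λ k → f k + g k))) ≡
  sum (toList (tabulate f)) + sum (toList (tabulate g))
sum-tabulate-+ zero    f g = refl
sum-tabulate-+ (suc n) f g = begin
  f fz + g fz + sum (toList (tabulate (λ k → f (fs k) + g (fs k))))
    ≡⟨ cong (f fz + g fz +_) (sum-tabulate-+ n (f ∘ fs) (g ∘ fs)) ⟩
  f fz + g fz + (sum (toList (tabulate (f ∘ fs))) + sum (toList (tabulate (g ∘ fs))))
    ≡⟨ interchange (f fz) (g fz) _ _ ⟩
  f fz + sum (toList (tabulate (f ∘ fs))) + (g fz + sum (toList (tabulate (g ∘ fs)))) ∎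
  where open ≡-Reasoning

card≡sum-tabulate : ∀ {n} (S : SubsetN n) → card S ≡ sum (toList (tabulate (count ∘ lookup S)))
card≡sum-tabulate Vec.[]       = refl
card≡sum-tabulate (b Vec.∷ S) = cong (count b +_) (card≡sum-tabulate S)

-- Exchanging the two summations in Σ_k c(T)_k.
sum-content : ∀ {n} (Ss : List (SubsetN n)) →
  sum (toList (tabulate (λ k → sum (map (λ S → count (lookup S k)) Ss)))) ≡ sum (map card Ss)
sum-content {n} []       = sum-tabulate-0 n
sum-content {n} (S ∷ Ss) = begin
  sum (toList (tabulate (λ k → count (lookup S k) + sum (map (λ S' → count (lookup S' k)) Ss))))
    ≡⟨ sum-tabulate-+ n (count ∘ lookup S) _ ⟩
  sum (toList (tabulate (count ∘ lookup S))) + sum (toList (tabulate (λ k → sum (map (λ S' → count (lookup S' k)) Ss))))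
    ≡⟨ cong₂ _+_ (sym (card≡sum-tabulate S)) (sum-content Ss) ⟩
  card S + sum (map card Ss) ∎
  where open ≡-Reasoning

sum-map-card-concat : ∀ {n} (F : Filling n) → sum (map card (concat F)) ≡ cardᶠ F
sum-map-card-concat []      = refl
sum-map-card-concat (r ∷ F) = begin
  sum (map card (r ++ concat F))              ≡⟨ cong sum (map-++ card r (concat F)) ⟩
  sum (map card r ++ map card (concat F))     ≡⟨ sum-++ (map card r) _ ⟩
  cardʳ r + sum (map card (concat F))          ≡⟨ cong (cardʳ r +_) (sum-map-card-concat F) ⟩
  cardʳ r + cardᶠ F ∎
  where open ≡-Reasoning

dT≡cardᶠ : ∀ {n} (F : Filling n) → dT F ≡ cardᶠ F
dT≡cardᶠ F = trans (sum-content (concat F)) (sum-map-card-concat F)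

∈-allSubsets : ∀ n (S : SubsetN n) → S ∈ allSubsets n
∈-allSubsets zero    Vec.[]           = here refl
∈-allSubsets (suc n) (b Vec.∷ S) = ∈-concatMap⁺ (λ s → (false Vec.∷ s) ∷ (true Vec.∷ s) ∷ [])
  (Any.map (λ { refl → extend b }) (∈-allSubsets n S))
  where
  extend : ∀ b → (b Vec.∷ S) ∈ (false Vec.∷ S) ∷ (true Vec.∷ S) ∷ []
  extend false = here refl
  extend true  = there (here refl)

∈-rowsOf : ∀ n (r : List (SubsetN n)) → r ∈ rowsOf n (length r)
∈-rowsOf n []      = here refl
∈-rowsOf n (S ∷ r) = ∈-concatMap⁺ (λ S' → map (S' ∷_) (rowsOf n (length r)))
  (Any.map (λ { refl → ∈-map⁺ (S ∷_) (∈-rowsOf n r) }) (∈-allSubsets n S))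

∈-fillings : ∀ n (F : Filling n) → F ∈ fillings n (map length F)
∈-fillings n []      = here refl
∈-fillings n (r ∷ F) = ∈-concatMap⁺ (λ r' → map (r' ∷_) (fillings n (map length F)))
  (Any.map (λ { refl → ∈-map⁺ (r ∷_) (∈-fillings n F) }) (∈-rowsOf n r))

rowsOf-length : ∀ n k {r : List (SubsetN n)} → r ∈ rowsOf n k → length r ≡ k
rowsOf-length n zero    (here refl) = refl
rowsOf-length n (suc k) r∈ with find (∈-concatMap⁻ (λ S → map (S ∷_) (rowsOf n k)) {xs = allSubsets n} r∈)
... | S , _ , r∈′ with ∈-map⁻ (S ∷_) r∈′
...   | r′ , r′∈ , refl = cong suc (rowsOf-length n k r′∈)

fillings-shape : ∀ n λ' {F : Filling n} → F ∈ fillings n λ' → map length F ≡ λ'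
fillings-shape n []       (here refl) = refl
fillings-shape n (k ∷ ks) F∈ with find (∈-concatMap⁻ (λ r → map (r ∷_) (fillings n ks)) {xs = rowsOf n k} F∈)
... | r , r∈ , F∈′ with ∈-map⁻ (r ∷_) F∈′
...   | F′ , F′∈ , refl = cong₂ _∷_ (rowsOf-length n k r∈) (fillings-shape n ks F′∈)

∈-SVT⁻ : ∀ n λ' {F : Filling n} → F ∈ SVT n λ' → map length F ≡ λ' × T (isSVT F)
∈-SVT⁻ n λ' F∈ =
  let (F∈fillings , svt) = ∈-filter⁻ (λ F → isSVT F B.≟ true) {xs = fillings n λ'} F∈
  in fillings-shape n λ' F∈fillings , Equivalence.from T-≡ svt

∈-SVT⁺ : ∀ n (F : Filling n) → T (isSVT F) → F ∈ SVT n (map length F)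
∈-SVT⁺ n F svt = ∈-filter⁺ (λ F → isSVT F B.≟ true) (∈-fillings n F) (Equivalence.to T-≡ svt)

NonemptyRow : ∀ {n} → List (SubsetN n) → Set
NonemptyRow = All (T ∘ nonempty)

IsSVT : ∀ {n} → Filling n → Set
IsSVT F = All NonemptyRow F × All (T ∘ rowOK) F × T (columnsOK F)

isSVT⁻ : ∀ {n} (F : Filling n) → T (isSVT F) → IsSVT F
isSVT⁻ F svt =
  let (boxes , rows , cols) = Product.map₂ (T-∧⁻ {and (map rowOK F)}) (T-∧⁻ svt)
  in concat⁻ (all⁺ nonempty (concat F) boxes) , all⁺ rowOK F rows , cols

isSVT⁺ : ∀ {n} (F : Filling n) → IsSVT F → T (isSVT F)
isSVT⁺ F (boxes , rows , cols) =
  T-∧⁺ (all⁻ nonempty (concat⁺ boxes)) (T-∧⁺ (all⁻ rowOK rows) cols)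

columnsOK-tail : ∀ {n} (r : List (SubsetN n)) rs → T (columnsOK (r ∷ rs)) → T (columnsOK rs)
columnsOK-tail r []       _    = _
columnsOK-tail r (r′ ∷ rs) cols = proj₂ (T-∧⁻ {colOK r r′} cols)

rowOK-take : ∀ {n} k (r : List (SubsetN n)) → T (rowOK r) → T (rowOK (take k r))
rowOK-take zero          r             _  = _
rowOK-take (suc k)       []            _  = _
rowOK-take (suc zero)    (S ∷ r)       _  = _
rowOK-take (suc (suc k)) (S ∷ [])      _  = _
rowOK-take (suc (suc k)) (S ∷ S′ ∷ r) ok =
  let (S≤S′ , ok′) = T-∧⁻ {allLe S S′} ok
  in T-∧⁺ S≤S′ (rowOK-take (suc k) (S′ ∷ r) ok′)

colOK-take : ∀ {n} k (r r′ : List (SubsetN n)) → T (colOK r r′) → T (colOK (take k r) (take k r′))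
colOK-take zero    r       r′        _  = _
colOK-take (suc k) []      r′        _  = _
colOK-take (suc k) (S ∷ r) []        _  = _
colOK-take (suc k) (S ∷ r) (S′ ∷ r′) ok =
  let (S<S′ , ok′) = T-∧⁻ {allLt S S′} ok
  in T-∧⁺ S<S′ (colOK-take k r r′ ok′)

columnsOK-take : ∀ {n} k (F : Filling n) → T (columnsOK F) → T (columnsOK (map (take k) F))
columnsOK-take k []            _    = _
columnsOK-take k (r ∷ [])      _    = _
columnsOK-take k (r ∷ r′ ∷ F) cols =
  let (ok , cols′) = T-∧⁻ {colOK r r′} cols
  in T-∧⁺ (colOK-take k r r′ ok) (columnsOK-take k (r′ ∷ F) cols′)

IsSVT-take : ∀ {n} k (F : Filling n) → IsSVT F → IsSVT (map (take k) F)
IsSVT-take k F (boxes , rows , cols) =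
  All.map⁺ (All.map (take⁺ k) boxes) ,
  All.map⁺ (All.map (rowOK-take k _) rows) ,
  columnsOK-take k F cols

Decreasing-tail : ∀ {x xs} → Decreasing (x ∷ xs) → Decreasing xs
Decreasing-tail [ _ ]   = []
Decreasing-tail (_ ∷ d) = d

Decreasing-head : ∀ {x xs} → Decreasing (x ∷ xs) → All (_≤ x) xs
Decreasing-head [ _ ]     = []
Decreasing-head (y≤x ∷ d) = y≤x ∷ All.map (λ z≤y → ≤-trans z≤y y≤x) (Decreasing-head d)

Decreasing-take : ∀ {A : Set} k (F : List (List A)) →
  Decreasing (map length F) → Decreasing (map length (map (take k) F))
Decreasing-take k []            _        = []
Decreasing-take k (r ∷ [])      _        = [ _ ]
Decreasing-take k (r ∷ r′ ∷ F) (le ∷ d) =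
  subst₂ _≤_ (sym (length-take k r′)) (sym (length-take k r)) (⊓-monoʳ-≤ k le) ∷ Decreasing-take k (r′ ∷ F) d

Width≤ : ∀ {A : Set} → ℕ → List (List A) → Set
Width≤ c = All ((_≤ c) ∘ length)

Width≤-take : ∀ {A : Set} k (F : List (List A)) → Width≤ k (map (take k) F)
Width≤-take k F = All.map⁺ (All.tabulate λ {r} _ → subst (_≤ k) (sym (length-take k r)) (m⊓n≤m k _))

EntriesFrom : ∀ {n} → ℕ → SubsetN n → Set
EntriesFrom L S = ∀ {p} → p ∈ₛ S → L ≤ toℕ p

BottomFrom : ∀ {n} → ℕ → Filling n → Set
BottomFrom L []      = ⊤
BottomFrom L (r ∷ _) = All (EntriesFrom L) r

-- The degree bound

-- degBound n c L λ bounds the number of entries of a tableau of shape min(λ, c) whose bottom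
-- row avoids the first L values (entries are 0-based positions Fin n).
degBound  : ℕ → ℕ → ℕ → List ℕ → ℕ
hookBound : ℕ → ℕ → ℕ → List ℕ → ℕ

degBound n c L []       = 0
degBound n c L (x ∷ xs) = hookBound n L (x ⊓ c) xs

hookBound n L zero    xs = 0
hookBound n L (suc y) xs = y + (n ∸ L) + degBound n y (suc L) xs

hookBound-cong : ∀ n L v {xs xs′} → (∀ {y} → suc y ≡ v → degBound n y (suc L) xs ≡ degBound n y (suc L) xs′) →
  hookBound n L v xs ≡ hookBound n L v xs′
hookBound-cong n L zero    _  = refl
hookBound-cong n L (suc y) eq = cong (y + (n ∸ L) +_) (eq refl)

m≥o⇒m⊓n⊓o≡n⊓o : ∀ {m o} n → o ≤ m → m ⊓ n ⊓ o ≡ n ⊓ o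
m≥o⇒m⊓n⊓o≡n⊓o {m} {o} n o≤m = begin
  m ⊓ n ⊓ o   ≡⟨ cong (_⊓ o) (⊓-comm m n) ⟩
  n ⊓ m ⊓ o   ≡⟨ ⊓-assoc n m o ⟩
  n ⊓ (m ⊓ o) ≡⟨ cong (n ⊓_) (m≥n⇒m⊓n≡n o≤m) ⟩
  n ⊓ o ∎
  where open ≡-Reasoning

degBound-take : ∀ {A : Set} n c d L (F : List (List A)) → c ≤ d →
  degBound n c L (map length (map (take d) F)) ≡ degBound n c L (map length F)
degBound-take n c d L []      _   = refl
degBound-take n c d L (r ∷ F) c≤d rewrite length-take d r | m≥o⇒m⊓n⊓o≡n⊓o (length r) c≤d =
  hookBound-cong n L (length r ⊓ c) λ {y} eq →
    degBound-take n y d (suc L) F (≤-trans (n≤1+n y) (≤-trans (≤-reflexive eq) (≤-trans (m⊓n≤n _ c) c≤d)))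

-- Upper bound

drop-last : ∀ {A : Set} y (r : List A) → length r ≡ suc y → Σ A λ B → drop y r ≡ B ∷ [] × B ∈ r
drop-last zero    (B ∷ []) _  = B , refl , here refl
drop-last (suc y) (S ∷ r)  eq = let (B , d , B∈) = drop-last y r (suc-injective eq) in B , d , there B∈

colOK-drop : ∀ {n} j (r r′ : List (SubsetN n)) {B B′ xs ys} → T (colOK r r′) →
  drop j r ≡ B ∷ xs → drop j r′ ≡ B′ ∷ ys → T (allLt B B′)
colOK-drop zero    (S ∷ r) (S′ ∷ r′) ok refl refl = proj₁ (T-∧⁻ {allLt S S′} ok)
colOK-drop (suc j) (S ∷ r) (S′ ∷ r′) ok d    d′   = colOK-drop j r r′ (proj₂ (T-∧⁻ {allLt S S′} ok)) d d′

row-EntriesFrom : ∀ {n} L (S : SubsetN n) rest → T (rowOK (S ∷ rest)) → NonemptyRow (S ∷ rest) →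
  EntriesFrom L S → All (EntriesFrom L) (S ∷ rest)
row-EntriesFrom L S []           _  _          from = from ∷ []
row-EntriesFrom L S (S′ ∷ rest) ok (neS ∷ ne) from =
  let (w , w∈S) = nonempty⇒∃ S neS
      (S≤S′ , ok′) = T-∧⁻ {allLe S S′} ok
  in from ∷ row-EntriesFrom L S′ rest ok′ ne (λ p∈S′ → ≤-trans (from w∈S) (allLe⇒≤ S S′ S≤S′ w∈S p∈S′))

cardʳ-take-drop : ∀ {n} k (r : List (SubsetN n)) → cardʳ r ≡ cardʳ (take k r) + cardʳ (drop k r)
cardʳ-take-drop zero    r       = refl
cardʳ-take-drop (suc k) []      = refl
cardʳ-take-drop (suc k) (S ∷ r) = trans (cong (card S +_) (cardʳ-take-drop k r)) (sym (+-assoc (card S) _ _))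

cardᶠ-take-drop : ∀ {n} k (F : Filling n) → cardᶠ F ≡ cardᶠ (map (take k) F) + cardᶠ (map (drop k) F)
cardᶠ-take-drop k []      = refl
cardᶠ-take-drop k (r ∷ F) = trans (cong₂ _+_ (cardʳ-take-drop k r) (cardᶠ-take-drop k F))
  (interchange (cardʳ (take k r)) (cardʳ (drop k r)) (cardᶠ (map (take k) F)) _)

cardᶠ-drop-narrow : ∀ {n} k (F : Filling n) → Width≤ k F → cardᶠ (map (drop k) F) ≡ 0
cardᶠ-drop-narrow k []      _         = refl
cardᶠ-drop-narrow k (r ∷ F) (r≤k ∷ w) rewrite drop-all k r r≤k = cardᶠ-drop-narrow k F w

-- Within a row the boxes weakly increase, so consecutive boxes share at most one value.
row-card-bound : ∀ {n} L (S : SubsetN n) rest {B M} → T (rowOK (S ∷ rest)) → NonemptyRow (S ∷ rest) →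
  EntriesFrom L S → drop (length rest) (S ∷ rest) ≡ B ∷ [] → M ∈ₛ B → (∀ {q} → q ∈ₛ B → toℕ q ≤ toℕ M) →
  cardʳ (S ∷ rest) + L ≤ toℕ M + suc (length rest)
row-card-bound L S [] {M = M} _ _ from refl M∈B max = begin
  card S + 0 + L ≡⟨ cong (_+ L) (+-identityʳ (card S)) ⟩
  card S + L     ≤⟨ card-⊆-interval S (m≤n⇒m≤1+n (from M∈B)) (λ p∈S → from p∈S , s≤s (max p∈S)) ⟩
  suc (toℕ M)    ≡⟨ +-comm 1 (toℕ M) ⟩
  toℕ M + 1      ∎
  where open ≤-Reasoning
row-card-bound L S (S′ ∷ rest) {M = M} ok (neS ∷ ne) from d M∈B max =
  let (w , w∈S) = nonempty⇒∃ S neS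
      (MS , MS∈S , maxS) = maximum S (w , w∈S)
      (S≤S′ , ok′) = T-∧⁻ {allLe S S′} ok
      boxS = card-⊆-interval S (m≤n⇒m≤1+n (from MS∈S)) (λ p∈S → from p∈S , s≤s (maxS p∈S))
      boxesS′ = row-card-bound (toℕ MS) S′ rest ok′ ne (allLe⇒≤ S S′ S≤S′ MS∈S) d M∈B max
  in begin
    card S + cardʳ (S′ ∷ rest) + L         ≡⟨ swap (card S) _ L ⟩
    card S + L + cardʳ (S′ ∷ rest)         ≤⟨ +-monoˡ-≤ _ boxS ⟩
    suc (toℕ MS) + cardʳ (S′ ∷ rest)       ≡⟨ cong suc (+-comm (toℕ MS) _) ⟩
    suc (cardʳ (S′ ∷ rest) + toℕ MS)       ≤⟨ s≤s boxesS′ ⟩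
    suc (toℕ M + suc (length rest))        ≡⟨ sym (+-suc (toℕ M) _) ⟩
    toℕ M + suc (suc (length rest))        ∎
  where
  open ≤-Reasoning
  swap : ∀ a b c → a + b + c ≡ a + c + b
  swap = solve-∀

-- Within a column the boxes strictly increase.
column-card-bound : ∀ {n} y (r : List (SubsetN n)) {B M} (rs : Filling n) → drop y r ≡ B ∷ [] →
  M ∈ₛ B → (∀ {q} → q ∈ₛ B → toℕ q ≤ toℕ M) → All NonemptyRow rs → T (columnsOK (r ∷ rs)) →
  Decreasing (map length rs) → Width≤ (suc y) rs → cardᶠ (map (drop y) rs) + suc (toℕ M) ≤ n
column-card-bound y r {M = M} [] _ _ _ _ _ _ _ = toℕ<n M
column-card-bound y r {B} {M} (r₁ ∷ rs) d M∈B max (ne₁ ∷ ne) cols dec (r₁≤ ∷ w) with length r₁ ≤? y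
... | yes r₁≤y rewrite drop-all y r₁ r₁≤y
                     | cardᶠ-drop-narrow y rs (All.map⁻ (All.map (λ le → ≤-trans le r₁≤y) (Decreasing-head dec))) =
  toℕ<n _
... | no r₁≰y =
  let (B₁ , d₁ , B₁∈) = drop-last y r₁ (≤-antisym r₁≤ (≰⇒> r₁≰y))
      (w₁ , w₁∈) = nonempty⇒∃ B₁ (All.lookup ne₁ B₁∈)
      (M₁ , M₁∈ , max₁) = maximum B₁ (w₁ , w₁∈)
      (B<B₁ , cols′) = T-∧⁻ {colOK r r₁} cols
      above : ∀ {q} → q ∈ₛ B₁ → toℕ M < toℕ q
      above = allLt⇒< B B₁ (colOK-drop y r r₁ B<B₁ d d₁) M∈B
      boxB₁ = card-⊆-interval B₁ (m≤n⇒m≤1+n (above M₁∈)) (λ q∈ → above q∈ , s≤s (max₁ q∈))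
      boxesAbove = column-card-bound y r₁ rs d₁ M₁∈ max₁ ne cols′ (Decreasing-tail dec) w
  in subst (λ z → cardʳ z + cardᶠ (map (drop y) rs) + suc (toℕ M) ≤ _) (sym d₁) (begin
    card B₁ + 0 + cardᶠ (map (drop y) rs) + suc (toℕ M) ≡⟨ swap (card B₁) _ (suc (toℕ M)) ⟩
    card B₁ + suc (toℕ M) + cardᶠ (map (drop y) rs)     ≤⟨ +-monoˡ-≤ _ boxB₁ ⟩
    suc (toℕ M₁) + cardᶠ (map (drop y) rs)              ≡⟨ +-comm (suc (toℕ M₁)) _ ⟩
    cardᶠ (map (drop y) rs) + suc (toℕ M₁)              ≤⟨ boxesAbove ⟩
    _                                                   ∎)
  where
  open ≤-Reasoning
  swap : ∀ a b c → a + 0 + b + c ≡ a + c + b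
  swap = solve-∀

IsSVT-tail : ∀ {n} (r : List (SubsetN n)) rs → IsSVT (r ∷ rs) → IsSVT rs
IsSVT-tail r rs (_ ∷ boxes , _ ∷ rows , cols) = boxes , rows , columnsOK-tail r rs cols

cardᶠ-width0 : ∀ {n} (F : Filling n) → Width≤ 0 F → cardᶠ F ≡ 0
cardᶠ-width0 []       _       = refl
cardᶠ-width0 ([] ∷ F) (_ ∷ w) = cardᶠ-width0 F w

hook-arithmetic : ∀ {a c L m y n} → a + L ≤ m + suc y → c + suc m ≤ n → L ≤ n → a + c ≤ y + (n ∸ L)
hook-arithmetic {a} {c} {L} {m} {y} {n} row col L≤n = begin
  a + c             ≡⟨ sym (m+n∸n≡m (a + c) L) ⟩
  a + c + L ∸ L     ≤⟨ ∸-monoˡ-≤ L (+-cancelʳ-≤ (suc m) _ _ total) ⟩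
  y + n ∸ L         ≡⟨ +-∸-assoc y L≤n ⟩
  y + (n ∸ L)       ∎
  where
  open ≤-Reasoning
  regroup₁ : ∀ a c L m → a + c + L + m ≡ (a + L) + (c + m)
  regroup₁ = solve-∀
  regroup₂ : ∀ m y n → m + (1 + y) + n ≡ y + n + (1 + m)
  regroup₂ = solve-∀
  total : a + c + L + suc m ≤ y + n + suc m
  total = begin
    a + c + L + suc m       ≡⟨ regroup₁ a c L (suc m) ⟩
    (a + L) + (c + suc m)   ≤⟨ +-mono-≤ row col ⟩
    m + suc y + n           ≡⟨ regroup₂ m y n ⟩
    y + n + suc m           ∎

-- The hook of the bottom row: the row itself and the column above its last box.
hook-card-bound : ∀ {n} L (S : SubsetN n) rest (rs : Filling n) → IsSVT ((S ∷ rest) ∷ rs) →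
  Decreasing (map length ((S ∷ rest) ∷ rs)) → EntriesFrom L S →
  cardʳ (S ∷ rest) + cardᶠ (map (drop (length rest)) rs) ≤ length rest + (n ∸ L)
hook-card-bound L S rest rs (ne ∷ nes , ok ∷ _ , cols) dec from =
  let y = length rest
      (B , dB , B∈) = drop-last y (S ∷ rest) refl
      (w , w∈) = nonempty⇒∃ B (All.lookup ne B∈)
      (M , M∈ , max) = maximum B (w , w∈)
      row = row-card-bound L S rest ok ne from dB M∈ max
      col = column-card-bound y (S ∷ rest) rs dB M∈ max nes cols
              (Decreasing-tail dec) (All.map⁻ (Decreasing-head dec))
      L≤M = All.lookup (row-EntriesFrom L S rest ok ne from) B∈ M∈
  in hook-arithmetic row col (≤-trans L≤M (<⇒≤ (toℕ<n M)))

BottomFrom-above : ∀ {n} L (S : SubsetN n) rest (rs : Filling n) y → IsSVT ((S ∷ rest) ∷ rs) →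
  EntriesFrom L S → BottomFrom (suc L) (map (take y) rs)
BottomFrom-above L S rest []                   y _ _ = _
BottomFrom-above L S rest ([] ∷ rs)            y _ _ = take⁺ y []
BottomFrom-above L S rest ((S₁ ∷ rest₁) ∷ rs) y ((neS ∷ _) ∷ ne₁ ∷ _ , _ ∷ ok₁ ∷ _ , cols) from =
  let (w , w∈S) = nonempty⇒∃ S neS
      S<S₁ = proj₁ (T-∧⁻ (proj₁ (T-∧⁻ cols)))
  in take⁺ y (row-EntriesFrom (suc L) S₁ rest₁ ok₁ ne₁ λ p∈S₁ →
       ≤-trans (s≤s (from w∈S)) (allLt⇒< S S₁ S<S₁ w∈S p∈S₁))

-- Induction on the number k of rows: the recursive call is on the truncated rows map (take y) rs.
cardᶠ≤degBound′ : ∀ {n} k (F : Filling n) → length F ≡ k → ∀ c L → IsSVT F →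
  Decreasing (map length F) → Width≤ c F → BottomFrom L F → cardᶠ F ≤ degBound n c L (map length F)
cardᶠ≤degBound′ k       []               _   c L _   _   _         _ = z≤n
cardᶠ≤degBound′ k       ([] ∷ rs)        _   c L _   dec _         _ =
  ≤-reflexive (cardᶠ-width0 rs (All.map⁻ (Decreasing-head dec)))
cardᶠ≤degBound′ {n} (suc k) ((S ∷ rest) ∷ rs) len c L svt dec (r≤c ∷ _) (fromS ∷ _)
  rewrite m≤n⇒m⊓n≡m r≤c = begin
    cardʳ r + cardᶠ rs                                              ≡⟨ cong (cardʳ r +_) (cardᶠ-take-drop y rs) ⟩
    cardʳ r + (cardᶠ (map (take y) rs) + cardᶠ (map (drop y) rs))   ≡⟨ regroup (cardʳ r) _ _ ⟩
    cardʳ r + cardᶠ (map (drop y) rs) + cardᶠ (map (take y) rs)     ≤⟨ +-mono-≤ hook upper ⟩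
    y + (n ∸ L) + degBound n y (suc L) (map length rs)              ∎
  where
  open ≤-Reasoning
  r = S ∷ rest
  y = length rest
  regroup : ∀ a b c → a + (b + c) ≡ a + c + b
  regroup = solve-∀
  hook = hook-card-bound L S rest rs svt dec fromS
  upper : cardᶠ (map (take y) rs) ≤ degBound n y (suc L) (map length rs)
  upper = subst (cardᶠ (map (take y) rs) ≤_) (degBound-take n y y (suc L) rs ≤-refl)
    (cardᶠ≤degBound′ k (map (take y) rs) (trans (length-map (take y) rs) (suc-injective len)) y (suc L)
      (IsSVT-take y rs (IsSVT-tail r rs svt)) (Decreasing-take y rs (Decreasing-tail dec))
      (Width≤-take y rs) (BottomFrom-above L S rest rs y svt fromS))

cardᶠ≤degBound : ∀ {n} (F : Filling n) c → IsSVT F → Decreasing (map length F) → Width≤ c F →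
  cardᶠ F ≤ degBound n c 0 (map length F)
cardᶠ≤degBound F c svt dec w = cardᶠ≤degBound′ (length F) F refl c 0 svt dec w (from0 F)
  where
  from0 : ∀ {n} (F : Filling n) → BottomFrom 0 F
  from0 []      = _
  from0 (r ∷ _) = All.tabulate λ _ _ → z≤n

-- Lower bound: an extremal tableau

TallColumn : ∀ {n} → ℕ → ℕ → Filling n → Set
TallColumn zero    j rows     = ⊤
TallColumn (suc t) j []       = ⊥
TallColumn (suc t) j (r ∷ rs) = j < length r × TallColumn t j rs

drop-box : ∀ {A : Set} j (r : List A) → j < length r → Σ A λ B → Σ (List A) λ xs → drop j r ≡ B ∷ xs × B ∈ r
drop-box zero    (B ∷ r) _         = B , r , refl , here refl
drop-box (suc j) (S ∷ r) (s≤s j<r) = let (B , xs , d , B∈) = drop-box j r j<r in B , xs , d , there B∈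

-- Column j strictly increases upwards, so an entry with t boxes above it is < n − t.
column-headroom : ∀ {n} t j (r : List (SubsetN n)) rs → All NonemptyRow (r ∷ rs) → T (columnsOK (r ∷ rs)) →
  TallColumn (suc t) j (r ∷ rs) → ∀ {B xs} → drop j r ≡ B ∷ xs → ∀ {p} → p ∈ₛ B → toℕ p + t < n
column-headroom zero    j r rs        _        _    _                  _ {p} _ =
  subst (_< _) (sym (+-identityʳ (toℕ p))) (toℕ<n p)
column-headroom (suc t) j r (r₁ ∷ rs) (_ ∷ ne) cols (_ , j<r₁ , tall) {B} d {p} p∈B =
  let (B₁ , xs₁ , d₁ , B₁∈) = drop-box j r₁ j<r₁
      (q , q∈B₁) = nonempty⇒∃ B₁ (All.lookup (All.lookup ne (here refl)) B₁∈)
      (ok , cols′) = T-∧⁻ {colOK r r₁} cols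
      p<q = allLt⇒< B B₁ (colOK-drop j r r₁ ok d d₁) p∈B q∈B₁
      above = column-headroom t j r₁ rs ne cols′ (j<r₁ , tall) d₁ q∈B₁
  in ≤-trans (s≤s (subst (_≤ toℕ q + t) (sym (+-suc (toℕ p) t)) (+-monoˡ-≤ t p<q))) above

appendColumn : ∀ {n} → ℕ → ℕ → Filling n → Filling n
appendColumn v zero    rows     = rows
appendColumn v (suc m) []       = []
appendColumn v (suc m) (r ∷ rs) = (r ++ interval v v ∷ []) ∷ appendColumn (suc v) m rs

LeadingWidth : ∀ {A : Set} → ℕ → ℕ → List (List A) → Set
LeadingWidth zero    y rows     = ⊤
LeadingWidth (suc m) y []       = ⊥
LeadingWidth (suc m) y (r ∷ rs) = length r ≡ y × LeadingWidth m y rs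

TrailingWidth≤ : ∀ {A : Set} → ℕ → ℕ → List (List A) → Set
TrailingWidth≤ zero    y rows     = Width≤ y rows
TrailingWidth≤ (suc m) y []       = ⊤
TrailingWidth≤ (suc m) y (r ∷ rs) = TrailingWidth≤ m y rs

LeadingWidth⇒TallColumn : ∀ {n} m y (rows : Filling n) → LeadingWidth m (suc y) rows → TallColumn m y rows
LeadingWidth⇒TallColumn zero    y rows     _            = _
LeadingWidth⇒TallColumn (suc m) y (r ∷ rs) (len , lead) = ≤-reflexive (sym len) , LeadingWidth⇒TallColumn m y rs lead

colOK-++-narrow : ∀ {n} (r c r′ : List (SubsetN n)) → length r′ ≤ length r → T (colOK r r′) →
  T (colOK (r ++ c) r′)
colOK-++-narrow []      []      []        _        _  = _
colOK-++-narrow []      (_ ∷ _) []        _        _  = _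
colOK-++-narrow (S ∷ r) c       []        _        _  = _
colOK-++-narrow (S ∷ r) c       (S′ ∷ r′) (s≤s le) ok =
  let (S<S′ , ok′) = T-∧⁻ {allLt S S′} ok in T-∧⁺ S<S′ (colOK-++-narrow r c r′ le ok′)

colOK-snoc : ∀ {n} (r r′ : List (SubsetN n)) B B′ → length r ≡ length r′ → T (colOK r r′) →
  T (allLt B B′) → T (colOK (r ++ B ∷ []) (r′ ++ B′ ∷ []))
colOK-snoc []      []        B B′ _  _  B<B′ = T-∧⁺ B<B′ _
colOK-snoc (S ∷ r) (S′ ∷ r′) B B′ eq ok B<B′ =
  let (S<S′ , ok′) = T-∧⁻ {allLt S S′} ok in T-∧⁺ S<S′ (colOK-snoc r r′ B B′ (suc-injective eq) ok′ B<B′)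

rowOK-snoc : ∀ {n} (S : SubsetN n) r B C → T (rowOK (S ∷ r)) → drop (length r) (S ∷ r) ≡ C ∷ [] →
  T (allLe C B) → T (rowOK (S ∷ r ++ B ∷ []))
rowOK-snoc S []       B .S _  refl C≤B = T-∧⁺ C≤B _
rowOK-snoc S (S′ ∷ r) B C  ok d    C≤B =
  let (S≤S′ , ok′) = T-∧⁻ {allLe S S′} ok in T-∧⁺ S≤S′ (rowOK-snoc S′ r B C ok′ d C≤B)

columnsOK-∷ : ∀ {n} (r : List (SubsetN n)) F → (∀ {r′ F′} → F ≡ r′ ∷ F′ → T (colOK r r′)) →
  T (columnsOK F) → T (columnsOK (r ∷ F))
columnsOK-∷ r []       _  _    = _
columnsOK-∷ r (r′ ∷ F) ok cols = T-∧⁺ (ok refl) cols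

singleton-< : ∀ {n} v → T (allLt {n} (interval v v) (interval (suc v) (suc v)))
singleton-< {n} v = <⇒allLt {n} (interval v v) (interval (suc v) (suc v)) λ p∈ q∈ →
  ≤-trans (s≤s (proj₂ (∈-interval⁻ v v p∈))) (proj₁ (∈-interval⁻ (suc v) (suc v) q∈))

rowOK-appendColumn : ∀ {n} v m (r : List (SubsetN n)) rs y → All NonemptyRow (r ∷ rs) → T (rowOK r) →
  T (columnsOK (r ∷ rs)) → length r ≡ y → LeadingWidth m y rs → v + suc m ≡ n →
  T (rowOK (r ++ interval v v ∷ []))
rowOK-appendColumn     v m []      rs y _  _  _    _    _    _  = _
rowOK-appendColumn {n} v m (S ∷ r) rs _ ne ok cols refl lead eq =
  let (C , dC , _) = drop-last (length r) (S ∷ r) refl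
      tall = LeadingWidth⇒TallColumn (suc m) (length r) ((S ∷ r) ∷ rs) (refl , lead)
  in rowOK-snoc S r (interval v v) C ok dC (≤⇒allLe C (interval v v) λ p∈C q∈ →
       ≤-trans (below (column-headroom m (length r) (S ∷ r) rs ne cols tall dC p∈C)) (proj₁ (∈-interval⁻ v v q∈)))
  where
  below : ∀ {p} → p + m < n → p ≤ v
  below {p} p+m<n = +-cancelʳ-≤ m p v (s≤s⁻¹ (subst (suc (p + m) ≤_) (trans (sym eq) (+-suc v m)) p+m<n))

colOK-appendColumn : ∀ {n} v m (r : List (SubsetN n)) rs y → T (columnsOK (r ∷ rs)) → length r ≡ y →
  LeadingWidth m y rs → TrailingWidth≤ m y rs →
  ∀ {r₂ F} → appendColumn (suc v) m rs ≡ r₂ ∷ F → T (colOK (r ++ interval v v ∷ []) r₂)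
colOK-appendColumn v zero    r (r₃ ∷ F₃) y cols len _          (r₃≤y ∷ _) refl =
  colOK-++-narrow r _ r₃ (subst (length r₃ ≤_) (sym len) r₃≤y) (proj₁ (T-∧⁻ cols))
colOK-appendColumn {n} v (suc m) r (r₃ ∷ F₃) y cols len (len₃ , _) _          refl =
  colOK-snoc r r₃ _ _ (trans len (sym len₃)) (proj₁ (T-∧⁻ cols)) (singleton-< {n} v)

IsSVT-appendColumn : ∀ {n} v m (rows : Filling n) y → IsSVT rows → LeadingWidth m y rows →
  TrailingWidth≤ m y rows → v + m ≡ n → IsSVT (appendColumn v m rows)
IsSVT-appendColumn v zero rows y svt _ _ _ = svt
IsSVT-appendColumn {n} v (suc m) (r ∷ rs) y svt@(ne ∷ nes , ok ∷ _ , cols) (len , lead) trail eq =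
  let (nes′ , oks′ , cols′) = IsSVT-appendColumn (suc v) m rs y (IsSVT-tail r rs svt) lead trail
                                (trans (sym (+-suc v m)) eq)
      v<n = subst (v <_) eq (m<m+n v (s≤s z≤n))
  in (All.++⁺ ne (interval-nonempty ≤-refl v<n ∷ []) ∷ nes′) ,
     (rowOK-appendColumn v m r rs y (ne ∷ nes) ok cols len lead eq ∷ oks′) ,
     columnsOK-∷ _ _ (colOK-appendColumn v m r rs y cols len lead trail) cols′

-- For decreasing xs, the number of parts ≥ k, i.e. the height of the k-th column.
columnLength : ℕ → List ℕ → ℕ
columnLength k []       = 0
columnLength k (x ∷ xs) = if k ≤ᵇ x then suc (columnLength k xs) else 0

columnLength-≤ : ∀ {k x} xs → k ≤ x → columnLength k (x ∷ xs) ≡ suc (columnLength k xs)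
columnLength-≤ xs k≤x rewrite Equivalence.to T-≡ (≤⇒≤ᵇ k≤x) = refl

columnLength-≰ : ∀ {k x} xs → ¬ k ≤ x → columnLength k (x ∷ xs) ≡ 0
columnLength-≰ {k} {x} xs k≰x with k ≤ᵇ x in eq
... | true  = ⊥-elim (k≰x (≤ᵇ⇒≤ k x (Equivalence.from T-≡ eq)))
... | false = refl

columnLength≤length : ∀ k xs → columnLength k xs ≤ length xs
columnLength≤length k []       = z≤n
columnLength≤length k (x ∷ xs) with k ≤ᵇ x
... | true  = s≤s (columnLength≤length k xs)
... | false = z≤n

map-⊓-id : ∀ {c} xs → All (_≤ c) xs → map (_⊓ c) xs ≡ xs
map-⊓-id xs xs≤c = map-id-local (All.map m≤n⇒m⊓n≡m xs≤c)

appendColumn-shape : ∀ {n} v (xs : List ℕ) (rows : Filling n) y c → suc y ≤ c → Decreasing xs →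
  All (λ x → x ⊓ c ≤ suc y) xs → map length rows ≡ map (_⊓ y) xs →
  map length (appendColumn v (columnLength (suc y) xs) rows) ≡ map (_⊓ c) xs
appendColumn-shape v []       []         y c _   _   _          _     = refl
appendColumn-shape v (x ∷ xs) (r ∷ rows) y c y<c dec (x⊓c≤ ∷ a) shape with suc y ≤? x
... | yes y<x rewrite columnLength-≤ xs y<x =
  let (len , shape′) = ∷-injective shape in
  cong₂ _∷_ (begin
      length (r ++ interval v v ∷ []) ≡⟨ length-++ r ⟩
      length r + 1                    ≡⟨ cong (_+ 1) len ⟩
      x ⊓ y + 1                       ≡⟨ cong (_+ 1) (m≥n⇒m⊓n≡n (≤-trans (n≤1+n y) y<x)) ⟩
      y + 1                           ≡⟨ +-comm y 1 ⟩
      suc y                           ≡⟨ ≤-antisym (⊓-glb y<x y<c) x⊓c≤ ⟩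
      x ⊓ c                           ∎)
    (appendColumn-shape (suc v) xs rows y c y<c (Decreasing-tail dec) a shape′)
  where open ≡-Reasoning
... | no y≮x rewrite columnLength-≰ xs y≮x =
  let x≤y = s≤s⁻¹ (≰⇒> y≮x)
      parts≤y = x≤y ∷ All.map (λ z≤x → ≤-trans z≤x x≤y) (Decreasing-head dec)
  in trans shape (trans (map-⊓-id (x ∷ xs) parts≤y)
                        (sym (map-⊓-id (x ∷ xs) (All.map (λ z≤y → ≤-trans z≤y (≤-trans (n≤1+n y) y<c)) parts≤y))))

columnLength-widths : ∀ {A : Set} (xs : List ℕ) (rows : List (List A)) y → map length rows ≡ map (_⊓ y) xs →
  LeadingWidth (columnLength (suc y) xs) y rows × TrailingWidth≤ (columnLength (suc y) xs) y rows
columnLength-widths []       []         y _ = _ , []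
columnLength-widths (x ∷ xs) (r ∷ rows) y shape with suc y ≤? x
... | yes y<x rewrite columnLength-≤ xs y<x =
  let (len , shape′) = ∷-injective shape
      (lead , trail) = columnLength-widths xs rows y shape′
  in (trans len (m≥n⇒m⊓n≡n (≤-trans (n≤1+n y) y<x)) , lead) , trail
... | no y≮x rewrite columnLength-≰ xs y≮x = _ , widths (x ∷ xs) (r ∷ rows) shape
  where
  widths : ∀ {A : Set} (zs : List ℕ) (rs : List (List A)) → map length rs ≡ map (_⊓ y) zs → Width≤ y rs
  widths []       []       _     = []
  widths (z ∷ zs) (r ∷ rs) shape = let (len , shape′) = ∷-injective shape in
    subst (_≤ y) (sym len) (m⊓n≤n z y) ∷ widths zs rs shape′

bottomRow : ∀ {n} → ℕ → ℕ → SubsetN n → List (SubsetN n)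
bottomRow y L C = replicate y (interval L L) ++ C ∷ []

bottomRow-length : ∀ {n} y L (C : SubsetN n) → length (bottomRow y L C) ≡ suc y
bottomRow-length y L C = trans (length-++ (replicate y (interval L L))) (trans (cong (_+ 1) (length-replicate y)) (+-comm y 1))

bottomRow-nonempty : ∀ {n} y L (C : SubsetN n) → L < n → T (nonempty C) → NonemptyRow (bottomRow y L C)
bottomRow-nonempty y L C L<n neC = All.++⁺ (All.replicate⁺ y (interval-nonempty ≤-refl L<n)) (neC ∷ [])

bottomRow-EntriesFrom : ∀ {n} y L (C : SubsetN n) → EntriesFrom L C → All (EntriesFrom L) (bottomRow y L C)
bottomRow-EntriesFrom y L C fromC = All.++⁺ (All.replicate⁺ y (proj₁ ∘ ∈-interval⁻ L L)) (fromC ∷ [])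

singleton≤ : ∀ {n} L (X : SubsetN n) → EntriesFrom L X → T (allLe (interval L L) X)
singleton≤ L X fromX = ≤⇒allLe (interval L L) X λ p∈ q∈ → ≤-trans (proj₂ (∈-interval⁻ L L p∈)) (fromX q∈)

bottomRow-rowOK : ∀ {n} y L (C : SubsetN n) → EntriesFrom L C → T (rowOK (bottomRow y L C))
bottomRow-rowOK zero          L C _     = _
bottomRow-rowOK (suc zero)    L C fromC = T-∧⁺ (singleton≤ L C fromC) _
bottomRow-rowOK {n} (suc (suc y)) L C fromC =
  T-∧⁺ (singleton≤ {n} L (interval L L) (proj₁ ∘ ∈-interval⁻ L L)) (bottomRow-rowOK (suc y) L C fromC)

bottomRow-colOK : ∀ {n} y L (C : SubsetN n) r → All (EntriesFrom (suc L)) r →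
  (∀ {D xs} → drop y r ≡ D ∷ xs → T (allLt C D)) → T (colOK (bottomRow y L C) r)
bottomRow-colOK zero    L C []      _              _   = _
bottomRow-colOK zero    L C (D ∷ r) _              C<D = T-∧⁺ (C<D refl) _
bottomRow-colOK (suc y) L C []      _              _   = _
bottomRow-colOK (suc y) L C (D ∷ r) (fromD ∷ from) C<D =
  T-∧⁺ (<⇒allLt (interval L L) D λ p∈ q∈ → ≤-trans (s≤s (proj₂ (∈-interval⁻ L L p∈))) (fromD q∈))
       (bottomRow-colOK y L C r from C<D)

singleton-card : ∀ {n} L → L < n → 1 ≤ card (interval {n} L L)
singleton-card {n} L L<n =
  subst (_≤ card (interval {n} L L)) (m+n∸n≡m 1 L) (card-⊇-interval (interval L L) L L L<n ∈-interval⁺)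

bottomRow-card : ∀ {n} y L (C : SubsetN n) → L < n → y + card C ≤ cardʳ (bottomRow y L C)
bottomRow-card zero    L C _   = ≤-reflexive (sym (+-identityʳ (card C)))
bottomRow-card (suc y) L C L<n = +-mono-≤ (singleton-card L L<n) (bottomRow-card y L C L<n)

emptyRows : ∀ {n} → List ℕ → Filling n
emptyRows = map (λ _ → [])

emptyRows-IsSVT : ∀ {n} L xs → IsSVT (emptyRows {n} xs) × All (All (EntriesFrom L)) (emptyRows {n} xs)
emptyRows-IsSVT L []           = ([] , [] , _) , []
emptyRows-IsSVT L (x ∷ [])     = ([] ∷ [] , _ ∷ [] , _) , [] ∷ []
emptyRows-IsSVT L (x ∷ x′ ∷ xs) =
  let ((ne , ok , cols) , from) = emptyRows-IsSVT L (x′ ∷ xs) in ([] ∷ ne , _ ∷ ok , cols) , [] ∷ from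

appendColumn-EntriesFrom : ∀ {n} L v m (rows : Filling n) → All (All (EntriesFrom L)) rows → L ≤ v →
  All (All (EntriesFrom L)) (appendColumn v m rows)
appendColumn-EntriesFrom L v zero    rows     from       _   = from
appendColumn-EntriesFrom L v (suc m) []       _          _   = []
appendColumn-EntriesFrom L v (suc m) (r ∷ rs) (fromr ∷ from) L≤v =
  All.++⁺ fromr ((λ p∈ → ≤-trans L≤v (proj₁ (∈-interval⁻ v v p∈))) ∷ []) ∷
  appendColumn-EntriesFrom L (suc v) m rs from (m≤n⇒m≤1+n L≤v)

cardʳ-snoc : ∀ {n} (r : List (SubsetN n)) B → cardʳ (r ++ B ∷ []) ≡ cardʳ r + (card B + 0)
cardʳ-snoc r B = trans (cong sum (map-++ card r (B ∷ []))) (sum-++ (map card r) (card B ∷ []))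

appendColumn-card : ∀ {n} v m (rows : Filling n) y → LeadingWidth m y rows → v + m ≤ n →
  m + cardᶠ rows ≤ cardᶠ (appendColumn v m rows)
appendColumn-card v zero rows y _ _ = ≤-refl
appendColumn-card {n} v (suc m) (r ∷ rs) y (_ , lead) v+m≤n =
  let v+m≤n′ = subst (_≤ n) (+-suc v m) v+m≤n
      box = singleton-card {n} v (≤-trans (s≤s (m≤m+n v m)) v+m≤n′)
      box′ = ≤-trans box (≤-reflexive (sym (+-identityʳ _)))
  in begin
    suc m + (cardʳ r + cardᶠ rs)
      ≡⟨ regroup m (cardʳ r) (cardᶠ rs) ⟩
    cardʳ r + 1 + (m + cardᶠ rs)
      ≤⟨ +-mono-≤ (+-monoʳ-≤ (cardʳ r) box′) (appendColumn-card (suc v) m rs y lead v+m≤n′) ⟩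
    cardʳ r + (card (interval {n} v v) + 0) + cardᶠ (appendColumn (suc v) m rs)
      ≡⟨ cong (_+ _) (sym (cardʳ-snoc r (interval v v))) ⟩
    cardʳ (r ++ interval v v ∷ []) + cardᶠ (appendColumn (suc v) m rs) ∎
  where
  open ≤-Reasoning
  regroup : ∀ m a b → 1 + m + (a + b) ≡ a + 1 + (m + b)
  regroup = solve-∀

drop-snoc : ∀ {A : Set} y (r : List A) B → length r ≡ y → drop y (r ++ B ∷ []) ≡ B ∷ []
drop-snoc zero    []      B _   = refl
drop-snoc (suc y) (x ∷ r) B len = drop-snoc y r B (suc-injective len)

appendColumn-box : ∀ {n} v m (rows : Filling n) y → LeadingWidth m y rows → TrailingWidth≤ m y rows →
  ∀ {r F} → appendColumn v m rows ≡ r ∷ F → ∀ {D xs} → drop y r ≡ D ∷ xs → D ≡ interval v v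
appendColumn-box v zero    (r ∷ rows) y _          (r≤y ∷ _) refl d with () ← trans (sym d) (drop-all y r r≤y)
appendColumn-box v (suc m) (r ∷ rows) y (len , _) _          refl d =
  proj₁ (∷-injective (trans (sym d) (drop-snoc y r (interval v v) len)))

-- extremal c L λ has shape min(λ, c) and bottom entries ≥ L.  Its bottom row is
-- {L}^y [L, n−1−m], where y + 1 = min(λ₁, c) and m is the height of column y + 1
-- above it; that column is filled with {n−m}, …, {n−1}, and the remaining rows are
-- extremal y (L + 1) of the rest of λ.
extremal  : ∀ {n} → ℕ → ℕ → List ℕ → Filling n
extremal′ : ∀ {n} → ℕ → ℕ → ℕ → List ℕ → Filling n

extremal c L []       = []
extremal c L (x ∷ xs) = extremal′ L (x ⊓ c) x xs

extremal′     L zero    x xs = emptyRows (x ∷ xs)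
extremal′ {n} L (suc y) x xs =
  let m = columnLength (suc y) xs in
  bottomRow y L (interval L (n ∸ suc m)) ∷ appendColumn (n ∸ m) m (extremal y (suc L) xs)

extremal-shape : ∀ {n} c L xs → Decreasing xs → map length (extremal {n} c L xs) ≡ map (_⊓ c) xs
extremal-shape c L [] _ = refl
extremal-shape {n} c L (x ∷ xs) dec with x ⊓ c in x⊓c≡
... | zero = cong (0 ∷_) (trans (sym (map-∘ xs))
  (map-cong-local (All.map (λ z≤x → sym (n≤0⇒n≡0 (capped z≤x))) (Decreasing-head dec))))
  where
  capped : ∀ {z} → z ≤ x → z ⊓ c ≤ 0
  capped z≤x = ≤-trans (⊓-monoˡ-≤ c z≤x) (≤-reflexive x⊓c≡)
... | suc y =
  cong₂ _∷_ (bottomRow-length y L _)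
    (appendColumn-shape (n ∸ columnLength (suc y) xs) xs (extremal y (suc L) xs) y c y<c (Decreasing-tail dec)
      (All.map (λ z≤x → ≤-trans (⊓-monoˡ-≤ c z≤x) (≤-reflexive x⊓c≡)) (Decreasing-head dec))
      (extremal-shape y (suc L) xs (Decreasing-tail dec)))
  where
  y<c : suc y ≤ c
  y<c = ≤-trans (≤-reflexive (sym x⊓c≡)) (m⊓n≤n x c)

-- n − 1 − m (0-based) is the top entry of the last bottom box, and n − m the first entry of
-- the column of height m above it.
record Room (n m L : ℕ) : Set where
  field
    L<n         : L < n
    top<n       : n ∸ suc m < n
    L≤top       : L ≤ n ∸ suc m
    suc-top≡n∸m : suc (n ∸ suc m) ≡ n ∸ m
    L<n∸m       : suc L ≤ n ∸ m
    n∸m+m≡n     : n ∸ m + m ≡ n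
    n∸L≡hook    : n ∸ L ≡ (suc (n ∸ suc m) ∸ L) + m

room : ∀ n m L → suc m + L ≤ n → Room n m L
room n m L m+L<n = record
  { L<n         = ≤-trans (s≤s (m≤n+m L m)) m+L<n
  ; top<n       = subst (_≤ n) (sym suc-top≡n∸m) (m∸n≤m n m)
  ; L≤top       = m+n≤o⇒m≤o∸n L L+m<n
  ; suc-top≡n∸m = suc-top≡n∸m
  ; L<n∸m       = m+n≤o⇒m≤o∸n (suc L) (subst (_≤ n) (+-suc L m) L+m<n)
  ; n∸m+m≡n     = m∸n+n≡m m≤n
  ; n∸L≡hook    = begin
      n ∸ L                   ≡⟨ sym (m∸n+n≡m (m+n≤o⇒m≤o∸n m (subst (_≤ n) (+-comm L m) L+m≤n))) ⟩
      n ∸ L ∸ m + m           ≡⟨ cong (_+ m) (∸-+-assoc n L m) ⟩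
      n ∸ (L + m) + m         ≡⟨ cong (λ k → n ∸ k + m) (+-comm L m) ⟩
      n ∸ (m + L) + m         ≡⟨ cong (_+ m) (sym (∸-+-assoc n m L)) ⟩
      n ∸ m ∸ L + m           ≡⟨ cong (λ k → k ∸ L + m) (sym suc-top≡n∸m) ⟩
      suc (n ∸ suc m) ∸ L + m ∎
  }
  where
  open ≡-Reasoning
  L+m<n : L + suc m ≤ n
  L+m<n = subst (_≤ n) (+-comm (suc m) L) m+L<n
  L+m≤n : L + m ≤ n
  L+m≤n = ≤-trans (+-monoʳ-≤ L (n≤1+n m)) L+m<n
  m≤n : m ≤ n
  m≤n = ≤-trans (n≤1+n m) (≤-trans (m≤m+n (suc m) L) m+L<n)
  suc-top≡n∸m : suc (n ∸ suc m) ≡ n ∸ m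
  suc-top≡n∸m = sym (+-∸-assoc 1 (≤-trans (m≤m+n (suc m) L) m+L<n))

extremal-IsSVT : ∀ {n} c L xs → Decreasing xs → length xs + L ≤ n →
  IsSVT (extremal {n} c L xs) × All (All (EntriesFrom L)) (extremal {n} c L xs)
extremal-IsSVT c L [] _ _ = ([] , [] , _) , []
extremal-IsSVT {n} c L (x ∷ xs) dec len with x ⊓ c
... | zero  = emptyRows-IsSVT L (x ∷ xs)
... | suc y =
  let m = columnLength (suc y) xs
      F = extremal {n} y (suc L) xs
      open Room (room n m L (≤-trans (+-monoˡ-≤ L (s≤s (columnLength≤length (suc y) xs))) len))
      C = interval {n} L (n ∸ suc m)
      fromC : EntriesFrom L C
      fromC = proj₁ ∘ ∈-interval⁻ L (n ∸ suc m)
      (svtF , fromF) = extremal-IsSVT y (suc L) xs (Decreasing-tail dec)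
                         (subst (_≤ n) (sym (+-suc (length xs) L)) len)
      (lead , trail) = columnLength-widths xs F y (extremal-shape y (suc L) xs (Decreasing-tail dec))
      (neA , okA , colsA) = IsSVT-appendColumn (n ∸ m) m F y svtF lead trail n∸m+m≡n
      fromA = appendColumn-EntriesFrom (suc L) (n ∸ m) m F fromF L<n∸m
      C<column : T (allLt C (interval (n ∸ m) (n ∸ m)))
      C<column = <⇒allLt C (interval (n ∸ m) (n ∸ m)) λ p∈ q∈ →
        ≤-trans (s≤s (proj₂ (∈-interval⁻ L (n ∸ suc m) p∈)))
                (≤-trans (≤-reflexive suc-top≡n∸m) (proj₁ (∈-interval⁻ (n ∸ m) (n ∸ m) q∈)))
      colOK-bottom : ∀ {r₂ F′} → appendColumn (n ∸ m) m F ≡ r₂ ∷ F′ → T (colOK (bottomRow y L C) r₂)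
      colOK-bottom eq =
        bottomRow-colOK y L C _ (All.lookup (subst (All (All (EntriesFrom (suc L)))) eq fromA) (here refl)) λ d → subst (T ∘ allLt C) (sym (appendColumn-box (n ∸ m) m F y lead trail eq d)) C<column
  in (bottomRow-nonempty y L C L<n (interval-nonempty L≤top top<n) ∷ neA ,
      bottomRow-rowOK y L C fromC ∷ okA ,
      columnsOK-∷ _ _ colOK-bottom colsA) ,
     bottomRow-EntriesFrom y L C fromC ∷
       All.map (All.map (λ from {p} p∈ → ≤-trans (n≤1+n L) (from p∈))) fromA

degBound≤extremal-card : ∀ {n} c L xs → Decreasing xs → length xs + L ≤ n →
  degBound n c L xs ≤ cardᶠ (extremal {n} c L xs)
degBound≤extremal-card c L [] _ _ = z≤n
degBound≤extremal-card {n} c L (x ∷ xs) dec len with x ⊓ c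
... | zero  = z≤n
... | suc y =
  let m = columnLength (suc y) xs
      F = extremal {n} y (suc L) xs
      open Room (room n m L (≤-trans (+-monoˡ-≤ L (s≤s (columnLength≤length (suc y) xs))) len))
      C = interval {n} L (n ∸ suc m)
      rest = degBound≤extremal-card y (suc L) xs (Decreasing-tail dec)
               (subst (_≤ n) (sym (+-suc (length xs) L)) len)
      (lead , _) = columnLength-widths xs F y (extremal-shape y (suc L) xs (Decreasing-tail dec))
      cardC = card-⊇-interval C L (n ∸ suc m) top<n ∈-interval⁺
      bottom = ≤-trans (+-monoʳ-≤ y cardC) (bottomRow-card y L C L<n)
      columnAbove = appendColumn-card (n ∸ m) m F y lead (≤-reflexive n∸m+m≡n)
  in begin
    y + (n ∸ L) + degBound n y (suc L) xs                ≤⟨ +-monoʳ-≤ (y + (n ∸ L)) rest ⟩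
    y + (n ∸ L) + cardᶠ F                                ≡⟨ cong (λ k → y + k + cardᶠ F) n∸L≡hook ⟩
    y + (suc (n ∸ suc m) ∸ L + m) + cardᶠ F              ≡⟨ regroup y _ m (cardᶠ F) ⟩
    y + (suc (n ∸ suc m) ∸ L) + (m + cardᶠ F)            ≤⟨ +-mono-≤ bottom columnAbove ⟩
    cardʳ (bottomRow y L C) + cardᶠ (appendColumn (n ∸ m) m F) ∎
  where
  open ≤-Reasoning
  regroup : ∀ a b c d → a + (b + c) + d ≡ a + b + (c + d)
  regroup = solve-∀

signPow-unit : ∀ k → signPow k ≡ 1ℤ ⊎ signPow k ≡ -1ℤ
signPow-unit zero    = inj₁ refl
signPow-unit (suc k) with signPow-unit k
... | inj₁ eq rewrite eq = inj₂ refl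
... | inj₂ eq rewrite eq = inj₁ refl

sumℤ-all-1 : ∀ ys → All (_≡ 1ℤ) ys → sumℤ ys ≡ ℤ.+ length ys
sumℤ-all-1 []       []         = refl
sumℤ-all-1 (_ ∷ ys) (refl ∷ a) rewrite sumℤ-all-1 ys a = refl

sumℤ-all-−1 : ∀ y ys → All (_≡ -1ℤ) (y ∷ ys) → sumℤ (y ∷ ys) ≡ -[1+ length ys ]
sumℤ-all-−1 _ []        (refl ∷ [])  = refl
sumℤ-all-−1 _ (y′ ∷ ys) (refl ∷ a)   rewrite sumℤ-all-−1 y′ ys a = refl

sumℤ-units≢0 : ∀ {s} y ys → s ≡ 1ℤ ⊎ s ≡ -1ℤ → All (_≡ s) (y ∷ ys) → sumℤ (y ∷ ys) ≢ 0ℤ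
sumℤ-units≢0 y ys (inj₁ refl) a eq with () ← trans (sym (sumℤ-all-1 (y ∷ ys) a)) eq
sumℤ-units≢0 y ys (inj₂ refl) a eq with () ← trans (sym (sumℤ-all-−1 y ys a)) eq

G≢0 : ∀ λ' n {F} → F ∈ SVT n λ' → G λ' n (content F) ≢ 0ℤ
G≢0 λ' n {F} F∈ = nonzero (∈-filter⁺ content≟ F∈ refl) (All.all-filter content≟ (SVT n λ'))
  where
  content≟ = λ F′ → ≡-dec _≟_ (content F′) (content F)
  sign = λ F′ → signPow (dT F′ ∸ size λ')
  nonzero : ∀ {Fs} → F ∈ Fs → All (λ F′ → content F′ ≡ content F) Fs → sumℤ (map sign Fs) ≢ 0ℤ
  nonzero {F′ ∷ Fs} _ same = sumℤ-units≢0 (sign F′) (map sign Fs) (signPow-unit (dT F ∸ size λ'))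
    (All.map⁺ (All.map (λ eq → cong (λ a → signPow (totalDeg a ∸ size λ')) eq) same))

G≢0⇒∈SVT : ∀ λ' n a → G λ' n a ≢ 0ℤ → ∃ λ F → F ∈ SVT n λ' × content F ≡ a
G≢0⇒∈SVT λ' n a a≢0 =
  let (F , F∈) = some-term (filter content≟ (SVT n λ')) a≢0
  in F , ∈-filter⁻ content≟ {xs = SVT n λ'} F∈
  where
  content≟ = λ F → ≡-dec _≟_ (content F) a
  some-term : ∀ Fs → sumℤ (map (λ F → signPow (dT F ∸ size λ')) Fs) ≢ 0ℤ → ∃ (_∈ Fs)
  some-term []       ≢0 = ⊥-elim (≢0 refl)
  some-term (F ∷ Fs) _  = F , here refl

SVT-card≤degBound : ∀ λ' c n → Decreasing λ' → All (_≤ c) λ' →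
  ∀ {F} → F ∈ SVT n λ' → cardᶠ F ≤ degBound n c 0 λ'
SVT-card≤degBound λ' c n dec λ≤c {F} F∈ with ∈-SVT⁻ n λ' F∈
... | refl , svt = cardᶠ≤degBound F c (isSVT⁻ F svt) dec (All.map⁻ λ≤c)

extremal-∈SVT : ∀ λ' c n → Decreasing λ' → All (_≤ c) λ' → length λ' ≤ n →
  extremal {n} c 0 λ' ∈ SVT n λ'
extremal-∈SVT λ' c n dec λ≤c len =
  let F = extremal {n} c 0 λ'
      shape = trans (extremal-shape c 0 λ' dec) (map-⊓-id λ' λ≤c)
      svt = proj₁ (extremal-IsSVT c 0 λ' dec (subst (_≤ n) (sym (+-identityʳ _)) len))
  in subst (λ μ → F ∈ SVT n μ) shape (∈-SVT⁺ n F (isSVT⁺ F svt))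

G-hasDegree : ∀ λ' c n → Decreasing λ' → All (_≤ c) λ' → length λ' ≤ n →
  HasDegree (G λ' n) (degBound n c 0 λ')
G-hasDegree λ' c n dec λ≤c len =
  (content F , G≢0 λ' n F∈ , trans (dT≡cardᶠ F) (≤-antisym (upper F∈) lower)) ,
  λ a a≢0 → let (F′ , F′∈ , eq) = G≢0⇒∈SVT λ' n a a≢0 in
    subst (λ a → totalDeg a ≤ _) eq (subst (_≤ _) (sym (dT≡cardᶠ F′)) (upper F′∈))
  where
  F = extremal {n} c 0 λ'
  F∈ = extremal-∈SVT λ' c n dec λ≤c len
  upper = SVT-card≤degBound λ' c n dec λ≤c
  lower = degBound≤extremal-card c 0 λ' dec (subst (_≤ n) (sym (+-identityʳ _)) len)

-- The largest strict partition

-- strictCore c λ: parts μᵢ = min(λᵢ, μᵢ₋₁ − 1), starting from μ₀ = c + 1, up to the first zero.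
strictCore  : ℕ → List ℕ → List ℕ
strictCore′ : ℕ → List ℕ → List ℕ

strictCore c []       = []
strictCore c (x ∷ xs) = strictCore′ (x ⊓ c) xs

strictCore′ zero    xs = []
strictCore′ (suc y) xs = suc y ∷ strictCore y xs

degBound-strictCore : ∀ n c L xs → degBound n c L (strictCore c xs) ≡ degBound n c L xs
degBound-strictCore n c L []       = refl
degBound-strictCore n c L (x ∷ xs) with x ⊓ c in x⊓c≡
... | zero  = refl
... | suc y rewrite m≤n⇒m⊓n≡m (≤-trans (≤-reflexive (sym x⊓c≡)) (m⊓n≤n x c)) =
  cong (y + (n ∸ L) +_) (degBound-strictCore n y (suc L) xs)

StrictlyDecreasing-∷ : ∀ {x xs} → All (_< x) xs → StrictlyDecreasing xs → StrictlyDecreasing (x ∷ xs)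
StrictlyDecreasing-∷ []        [] = [ _ ]
StrictlyDecreasing-∷ (y<x ∷ _) s  = y<x ∷ s

StrictlyDecreasing-tail : ∀ {x xs} → StrictlyDecreasing (x ∷ xs) → StrictlyDecreasing xs
StrictlyDecreasing-tail [ _ ]   = []
StrictlyDecreasing-tail (_ ∷ s) = s

StrictlyDecreasing⇒Decreasing : ∀ {xs} → StrictlyDecreasing xs → Decreasing xs
StrictlyDecreasing⇒Decreasing []        = []
StrictlyDecreasing⇒Decreasing [ x ]     = [ x ]
StrictlyDecreasing⇒Decreasing (y<x ∷ s) = <⇒≤ y<x ∷ StrictlyDecreasing⇒Decreasing s

strictCore-strict : ∀ c xs → IsStrictPartition (strictCore c xs) × All (_≤ c) (strictCore c xs)
strictCore-strict c []       = ([] , []) , []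
strictCore-strict c (x ∷ xs) with x ⊓ c in x⊓c≡
... | zero  = ([] , []) , []
... | suc y =
  let ((strict , pos) , ≤y) = strictCore-strict y xs
      y<c = ≤-trans (≤-reflexive (sym x⊓c≡)) (m⊓n≤n x c)
  in (StrictlyDecreasing-∷ (All.map s≤s ≤y) strict , s≤s z≤n ∷ pos) ,
     y<c ∷ All.map (λ z≤y → ≤-trans z≤y (≤-trans (n≤1+n y) y<c)) ≤y

strictCore-⊆ : ∀ c xs → strictCore c xs ⊆ₚ xs
strictCore-⊆ c []       _ = z≤n
strictCore-⊆ c (x ∷ xs) i with x ⊓ c in x⊓c≡
... | zero  = z≤n
... | suc y with i
...   | zero   = ≤-trans (≤-reflexive (sym x⊓c≡)) (m⊓n≤m x c)
...   | suc i′ = strictCore-⊆ y xs i′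

strictCore-maximal : ∀ c xs ν → IsStrictPartition ν → ν ⊆ₚ xs → part ν 0 ≤ c → ν ⊆ₚ strictCore c xs
strictCore-maximal c []       ν        _                     ν⊆ _   i = ν⊆ i
strictCore-maximal c (x ∷ xs) []       _                     _  _   i = z≤n
strictCore-maximal c (x ∷ xs) (v ∷ ν) (strict , v>0 ∷ pos) ν⊆ v≤c i with x ⊓ c in x⊓c≡
... | zero  = ⊥-elim (<⇒≱ v>0 (≤-trans (⊓-glb (ν⊆ 0) v≤c) (≤-reflexive x⊓c≡)))
... | suc y with i
...   | zero   = ≤-trans (⊓-glb (ν⊆ 0) v≤c) (≤-reflexive x⊓c≡)
...   | suc i′ = strictCore-maximal y xs ν (StrictlyDecreasing-tail strict , pos) (ν⊆ ∘ suc)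
                   (head≤y ν strict (≤-trans (⊓-glb (ν⊆ 0) v≤c) (≤-reflexive x⊓c≡))) i′
  where
  head≤y : ∀ ν → StrictlyDecreasing (v ∷ ν) → v ≤ suc y → part ν 0 ≤ y
  head≤y []      _         _     = z≤n
  head≤y (w ∷ ν) (w<v ∷ _) v≤y+1 = s≤s⁻¹ (≤-trans w<v v≤y+1)

size-mono : ∀ xs ys → xs ⊆ₚ ys → size xs ≤ size ys
size-mono []       ys       _  = z≤n
size-mono (x ∷ xs) []       ⊆ = +-mono-≤ (⊆ 0) (size-mono xs [] (⊆ ∘ suc))
size-mono (x ∷ xs) (y ∷ ys) ⊆ = +-mono-≤ (⊆ 0) (size-mono xs ys (⊆ ∘ suc))

⊆ₚ-antisym-size : ∀ {xs ys} → Positive xs → Positive ys → xs ⊆ₚ ys → size ys ≤ size xs → xs ≡ ys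
⊆ₚ-antisym-size []         []         _ _ = refl
⊆ₚ-antisym-size []         (y>0 ∷ _)  _ s = ⊥-elim (<⇒≱ y>0 (≤-trans (m≤m+n _ _) s))
⊆ₚ-antisym-size (x>0 ∷ _)  []         ⊆ _ = ⊥-elim (<⇒≱ x>0 (⊆ 0))
⊆ₚ-antisym-size {x ∷ xs} {y ∷ ys} (_ ∷ px) (_ ∷ py) ⊆ s =
  let tails = size-mono xs ys (⊆ ∘ suc)
      x≡y = ≤-antisym (⊆ 0) (+-cancelʳ-≤ (size ys) y x (≤-trans s (+-monoʳ-≤ x tails)))
      tails′ = +-cancelˡ-≤ x (size ys) (size xs) (subst (λ z → z + size ys ≤ x + size xs) (sym x≡y) s)
  in cong₂ _∷_ x≡y (⊆ₚ-antisym-size px py (⊆ ∘ suc) tails′)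

⊆ₚ-length : ∀ {xs ys} → Positive xs → xs ⊆ₚ ys → length xs ≤ length ys
⊆ₚ-length {[]}                 _           _ = z≤n
⊆ₚ-length {x ∷ xs} {[]}     (x>0 ∷ _)  ⊆ = ⊥-elim (<⇒≱ x>0 (⊆ 0))
⊆ₚ-length {x ∷ xs} {y ∷ ys} (_ ∷ px)   ⊆ = s≤s (⊆ₚ-length {ys = ys} px (⊆ ∘ suc))

Decreasing-≤ : ∀ {c xs} → Decreasing xs → part xs 0 ≤ c → All (_≤ c) xs
Decreasing-≤ {xs = []}     _   _    = []
Decreasing-≤ {xs = x ∷ xs} dec x≤c = x≤c ∷ All.map (λ z≤x → ≤-trans z≤x x≤c) (Decreasing-head dec)

largestStrict≡strictCore : ∀ {λ' μ} → IsLargestStrictIn μ λ' → μ ≡ strictCore (part λ' 0) λ'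
largestStrict≡strictCore {λ'} {μ} (strictμ@(_ , posμ) , μ⊆λ , maximal) =
  let (coreStrict , _) = strictCore-strict (part λ' 0) λ'
  in ⊆ₚ-antisym-size posμ (proj₂ coreStrict)
       (strictCore-maximal (part λ' 0) λ' μ strictμ μ⊆λ (μ⊆λ 0))
       (maximal _ coreStrict (strictCore-⊆ (part λ' 0) λ'))

lemma5p3 : (λ' μ : List ℕ) → IsPartition λ' → IsLargestStrictIn μ λ' →
    (n : ℕ) → length λ' ≤ n →
    Σ ℕ (λ d → HasDegree (G μ n) d × HasDegree (G λ' n) d)
lemma5p3 λ' μ (decλ , _) largest@((strictμ , posμ) , μ⊆λ , _) n len =
  degBound n c 0 λ' ,
  subst (HasDegree (G μ n)) sameBound (G-hasDegree μ c n decμ (Decreasing-≤ decμ (μ⊆λ 0)) lenμ) ,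
  G-hasDegree λ' c n decλ (Decreasing-≤ decλ ≤-refl) len
  where
  c = part λ' 0
  decμ = StrictlyDecreasing⇒Decreasing strictμ
  lenμ = ≤-trans (⊆ₚ-length {ys = λ'} posμ μ⊆λ) len
  sameBound : degBound n c 0 μ ≡ degBound n c 0 λ'
  sameBound = trans (cong (degBound n c 0) (largestStrict≡strictCore {λ'} largest)) (degBound-strictCore n c 0 λ')
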